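{- Consider $\mathbb{Q}$ as a dihedral rack with operation $x\triangleright y=2x-y$. Then the lattice $\mathcal{R}(\mathbb{Q})$ of subracks of $\mathbb{Q}$ is not complemented.
   Context: A rack is a set $R$ with a binary operation $\triangleright$ such that $a\triangleright(b\triangleright c)=(a\triangleright b)\triangleright(a\triangleright c)$ for all $a,b,c\in R$, and for all $a,b\in R$ there is a unique $x\in R$ with $a\triangleright x=b$. A subrack is a subset $Q$ with $(Q,\triangleright)$ a rack (including $\emptyset$); $\ll S\gg$ is the intersection of all subracks containing $S$. $\mathcal{R}(R)$ is the lattice of subracks ordered by inclusion, with meet the intersection, join $\ll Q\cup Q'\gg$, bottom $\emptyset$ and top $R$. It is complemented if every subrack $Q$ has a subrack $Q'$ with $Q\cap Q'=\emptyset$ and $\ll Q\cup Q'\gg=R$. -}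

module Defs where

open import Level using (Level; 0ℓ; suc)
open import Data.Product using (Σ; ∃; _×_; _,_)
open import Data.Sum using (_⊎_)
open import Data.Empty using (⊥)
open import Data.Integer using (+_)
open import Data.Rational using (ℚ; _/_; _*_; _-_)
open import Relation.Unary using (Pred)
open import Relation.Binary.PropositionalEquality using (_≡_)

module RackNotions {A : Set} (_▷_ : A → A → A) where

  ∃!In : Pred A 0ℓ → Pred A 0ℓ → Set
  ∃!In Q P = Σ A λ x → Q x × P x × (∀ y → Q y → P y → y ≡ x)

  IsSubrack : Pred A 0ℓ → Set
  IsSubrack Q =
    (∀ {a b} → Q a → Q b → Q (a ▷ b)) ×
    (∀ {a b c} → Q a → Q b → Q c → a ▷ (b ▷ c) ≡ (a ▷ b) ▷ (a ▷ c)) ×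
    (∀ {a b} → Q a → Q b → ∃!In Q (λ x → a ▷ x ≡ b))

  ⟪_⟫ : Pred A 0ℓ → Pred A (suc 0ℓ)
  ⟪ S ⟫ x = (P : Pred A 0ℓ) → IsSubrack P → (∀ y → S y → P y) → P x

  IsComplement : Pred A 0ℓ → Pred A 0ℓ → Set₁
  IsComplement Q Q' =
    IsSubrack Q' ×
    (∀ x → Q x → Q' x → ⊥) ×
    (∀ x → ⟪ (λ y → Q y ⊎ Q' y) ⟫ x)

  Complemented : Set₁
  Complemented = (Q : Pred A 0ℓ) → IsSubrack Q → Σ (Pred A 0ℓ) λ Q' → IsComplement Q Q'

2ℚ : ℚ
2ℚ = + 2 / 1

_▷ℚ_ : ℚ → ℚ → ℚ
x ▷ℚ y = 2ℚ * x - y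

module Submission where

-- The singleton {0} is a subrack of the dihedral rack (ℚ, x ▷ y = 2x − y);
-- suppose Q' were a complement of it: a subrack not containing 0 with ≪ {0} ∪ Q' ≫ = ℚ.
--  * For dihedral racks every ▷-closed subset is a subrack, so anything generated by S lies
--    in every ▷-closed superset of S.  In particular Q' is inhabited, say q ∈ Q'.
--  * The translations d with Q' ± d ⊆ Q' form an additive subgroup N of ℚ, and it contains
--    2(a − b) for all a, b ∈ Q' (since a ▷ (b ▷ x) = x + 2(a − b)).
--  * For any additive subgroup N of ℚ, the set ℤq + ½N is ▷-closed; it contains 0 and, for
--    our N, all of Q'.  Hence it is all of ℚ.
--  * If ℤq + ½N = ℚ then q ∈ N: the point q/2 gives an odd n with nq ∈ N, and then the point
--    q/(2n) gives q ∈ N.  Consequently 0 = q − q ∈ Q', contradicting disjointness.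

open import Defs
open import Level using (0ℓ)
open import Data.Product using (Σ; _×_; _,_; proj₁; proj₂)
open import Data.Sum using (_⊎_; inj₁; inj₂)
open import Data.Empty using (⊥)
open import Relation.Nullary using (¬_)
open import Relation.Unary using (Pred)
open import Relation.Binary.PropositionalEquality
open import Data.Nat using (zero; suc)
import Data.Nat.Properties as ℕP
open import Data.Integer as ℤ using (ℤ; +_; -[1+_])
import Data.Integer.Properties as ℤP
import Data.Nat.Coprimality as Coprimality
open import Data.Rational as ℚ using (ℚ; mkℚ; _+_; _*_; _-_; -_; 0ℚ; 1ℚ; ½; 1/_)
import Data.Rational.Properties as ℚP
import Data.Rational.Unnormalised as ℚᵘ
import Data.Rational.Unnormalised.Properties as ℚᵘP
open import Data.Rational.Solver using (module +-*-Solver)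
open +-*-Solver using (solve; _:+_; _:*_; _:-_; :-_; con; _:=_)

open RackNotions _▷ℚ_

fromℤ : ℤ → ℚ
fromℤ i = mkℚ i 0 (Coprimality.sym (Coprimality.1-coprimeTo _))

fromℤ-+ : ∀ i j → fromℤ (i ℤ.+ j) ≡ fromℤ i + fromℤ j
fromℤ-+ i j = ℚP.toℚᵘ-injective
  (ℚᵘP.≃-trans (ℚᵘ.*≡* numerators) (ℚᵘP.≃-sym (ℚP.toℚᵘ-homo-+ (fromℤ i) (fromℤ j))))
  where
  numerators : (i ℤ.+ j) ℤ.* + 1 ≡ (i ℤ.* + 1 ℤ.+ j ℤ.* + 1) ℤ.* + 1
  numerators = cong (ℤ._* + 1) (sym (cong₂ ℤ._+_ (ℤP.*-identityʳ i) (ℤP.*-identityʳ j)))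

fromℤ-neg : ∀ i → fromℤ (ℤ.- i) ≡ - fromℤ i
fromℤ-neg i = ℚP.toℚᵘ-injective (ℚᵘP.≃-sym (ℚP.toℚᵘ-homo‿- (fromℤ i)))

odd≢0 : ∀ m → + 1 ℤ.- (m ℤ.+ m) ≢ + 0
odd≢0 (+ zero)   ()
odd≢0 (+ suc k)  e rewrite ℕP.+-suc k k with e
... | ()
odd≢0 -[1+ k ]   ()

fromℤ-odd≢0 : ∀ m → fromℤ (+ 1 ℤ.- (m ℤ.+ m)) ≢ 0ℚ
fromℤ-odd≢0 m e = odd≢0 m (cong ℚ.numerator e)

Closed : Pred ℚ 0ℓ → Set
Closed P = ∀ {a b} → P a → P b → P (a ▷ℚ b)

▷-involutive : ∀ a b → a ▷ℚ (a ▷ℚ b) ≡ b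
▷-involutive = solve 2 (λ a b → con 2ℚ :* a :- (con 2ℚ :* a :- b) := b) refl

▷-selfDistributive : ∀ a b c → a ▷ℚ (b ▷ℚ c) ≡ (a ▷ℚ b) ▷ℚ (a ▷ℚ c)
▷-selfDistributive = solve 3 (λ a b c →
  con 2ℚ :* a :- (con 2ℚ :* b :- c)
    := con 2ℚ :* (con 2ℚ :* a :- b) :- (con 2ℚ :* a :- c)) refl

-- In a dihedral rack every ▷-closed subset is a subrack: self-distributivity holds globally
-- and the unique solution of a ▷ x = b is x = a ▷ b, by involutivity.
closed⇒subrack : ∀ {P} → Closed P → IsSubrack P
closed⇒subrack {P} closed =
  closed , (λ {a b c} _ _ _ → ▷-selfDistributive a b c) , solution
  where
  solution : ∀ {a b} → P a → P b → ∃!In P (λ x → a ▷ℚ x ≡ b)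
  solution {a} {b} pa pb = a ▷ℚ b , closed pa pb , ▷-involutive a b ,
    λ y _ a▷y≡b → trans (sym (▷-involutive a y)) (cong (a ▷ℚ_) a▷y≡b)

generated⊆closed : ∀ {S} P → Closed P → (∀ y → S y → P y) → ∀ x → ⟪ S ⟫ x → P x
generated⊆closed P closed S⊆P x x∈⟪S⟫ = x∈⟪S⟫ P (closed⇒subrack closed) S⊆P

IsZero : Pred ℚ 0ℓ
IsZero x = x ≡ 0ℚ

zero-closed : Closed IsZero
zero-closed refl refl = refl

-- If {0} ∪ Q' generates ℚ then Q' is inhabited, since {0} ∪ (Q' if inhabited) is ▷-closed
-- and does not contain 1.
complement-inhabited : ∀ {Q'} → (∀ x → ⟪ (λ y → IsZero y ⊎ Q' y) ⟫ x) → Σ ℚ Q'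
complement-inhabited {Q'} generates = witness (generated⊆closed P closed inclusion 1ℚ (generates 1ℚ))
  where
  P : Pred ℚ 0ℓ
  P x = IsZero x ⊎ Σ ℚ Q'
  closed : Closed P
  closed (inj₁ refl) (inj₁ refl) = inj₁ refl
  closed (inj₁ _)    (inj₂ w)    = inj₂ w
  closed (inj₂ w)    _           = inj₂ w
  inclusion : ∀ y → IsZero y ⊎ Q' y → P y
  inclusion y (inj₁ y≡0)  = inj₁ y≡0
  inclusion y (inj₂ y∈Q') = inj₂ (y , y∈Q')
  witness : P 1ℚ → Σ ℚ Q'
  witness (inj₁ ())
  witness (inj₂ w) = w

record IsAdditiveSubgroup (N : Pred ℚ 0ℓ) : Set where
  field
    0∈         : N 0ℚ
    +-closed   : ∀ {d e} → N d → N e → N (d + e)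
    neg-closed : ∀ {d} → N d → N (- d)

module AdditiveSubgroup {N : Pred ℚ 0ℓ} (G : IsAdditiveSubgroup N) where
  open IsAdditiveSubgroup G

  ℕ-multiple : ∀ n {d} → N d → N (fromℤ (+ n) * d)
  ℕ-multiple zero    {d} _  = subst N (sym (ℚP.*-zeroˡ d)) 0∈
  ℕ-multiple (suc n) {d} d∈ = subst N (sym (begin
    fromℤ (+ suc n) * d            ≡⟨ cong (_* d) (fromℤ-+ (+ 1) (+ n)) ⟩
    (1ℚ + fromℤ (+ n)) * d         ≡⟨ solve 2 (λ m d → (con 1ℚ :+ m) :* d := d :+ m :* d) refl (fromℤ (+ n)) d ⟩
    d + fromℤ (+ n) * d            ∎)) (+-closed d∈ (ℕ-multiple n d∈))
    where open ≡-Reasoning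

  ℤ-multiple : ∀ k {d} → N d → N (fromℤ k * d)
  ℤ-multiple (+ n)    d∈ = ℕ-multiple n d∈
  ℤ-multiple -[1+ n ] {d} d∈ = subst N (sym (begin
    fromℤ (ℤ.- + suc n) * d  ≡⟨ cong (_* d) (fromℤ-neg (+ suc n)) ⟩
    - fromℤ (+ suc n) * d    ≡⟨ solve 2 (λ m d → (:- m) :* d := :- (m :* d)) refl (fromℤ (+ suc n)) d ⟩
    - (fromℤ (+ suc n) * d)  ∎)) (neg-closed (ℕ-multiple (suc n) d∈))
    where open ≡-Reasoning

  -- x lies in the half-coset ℤq + ½N.
  HalfCoset : ℚ → Pred ℚ 0ℓ
  HalfCoset q x = Σ ℤ λ m → N (2ℚ * (x - fromℤ m * q))

  -- ℤq + ½N is ▷-closed: with m = 2m₁ − m₂,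
  -- 2((2a − b) − mq) = 2·[2(a − m₁q)] − 2(b − m₂q).
  halfCoset-closed : ∀ q → Closed (HalfCoset q)
  halfCoset-closed q {a} {b} (m₁ , d₁∈) (m₂ , d₂∈) =
    m , subst N (sym shift) (+-closed (+-closed d₁∈ d₁∈) (neg-closed d₂∈))
    where
    open ≡-Reasoning
    m : ℤ
    m = (m₁ ℤ.+ m₁) ℤ.- m₂
    M₁ M₂ : ℚ
    M₁ = fromℤ m₁
    M₂ = fromℤ m₂
    fromℤ-m : fromℤ m ≡ (M₁ + M₁) - M₂
    fromℤ-m = trans (fromℤ-+ (m₁ ℤ.+ m₁) (ℤ.- m₂)) (cong₂ _+_ (fromℤ-+ m₁ m₁) (fromℤ-neg m₂))
    shift : 2ℚ * ((a ▷ℚ b) - fromℤ m * q)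
          ≡ (2ℚ * (a - M₁ * q) + 2ℚ * (a - M₁ * q)) + - (2ℚ * (b - M₂ * q))
    shift = begin
      2ℚ * ((a ▷ℚ b) - fromℤ m * q)     ≡⟨ cong (λ z → 2ℚ * ((a ▷ℚ b) - z * q)) fromℤ-m ⟩
      2ℚ * ((a ▷ℚ b) - ((M₁ + M₁) - M₂) * q)
        ≡⟨ solve 5 (λ a b x y q →
             con 2ℚ :* ((con 2ℚ :* a :- b) :- ((x :+ x) :- y) :* q)
               := (con 2ℚ :* (a :- x :* q) :+ con 2ℚ :* (a :- x :* q)) :+ (:- (con 2ℚ :* (b :- y :* q))))
             refl a b M₁ M₂ q ⟩
      (2ℚ * (a - M₁ * q) + 2ℚ * (a - M₁ * q)) + - (2ℚ * (b - M₂ * q)) ∎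

  odd-multiple : ∀ q → HalfCoset q (q * ½) → Σ ℤ λ n → fromℤ n ≢ 0ℚ × N (fromℤ n * q)
  odd-multiple q (m , d∈) = n , fromℤ-odd≢0 m , subst N value d∈
    where
    open ≡-Reasoning
    n : ℤ
    n = + 1 ℤ.- (m ℤ.+ m)
    value : 2ℚ * (q * ½ - fromℤ m * q) ≡ fromℤ n * q
    value = begin
      2ℚ * (q * ½ - fromℤ m * q)
        ≡⟨ solve 2 (λ q m → con 2ℚ :* (q :* con ½ :- m :* q) := (con 1ℚ :- (m :+ m)) :* q) refl q (fromℤ m) ⟩
      (1ℚ - (fromℤ m + fromℤ m)) * q
        ≡⟨ cong (λ z → (1ℚ + z) * q) (sym (trans (fromℤ-neg (m ℤ.+ m)) (cong -_ (fromℤ-+ m m)))) ⟩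
      (1ℚ + fromℤ (ℤ.- (m ℤ.+ m))) * q ≡⟨ cong (_* q) (sym (fromℤ-+ (+ 1) (ℤ.- (m ℤ.+ m)))) ⟩
      fromℤ n * q ∎

  -- If nq ∈ N for some n ≠ 0 and q/(2n) ∈ ℤq + ½N, then q ∈ N: that point gives
  -- 2(q/(2n) − mq) ∈ N for some m, so q − 2m·nq ∈ N, and 2m·nq ∈ N.
  divide-multiple : ∀ q n ⦃ _ : ℚ.NonZero (fromℤ n) ⦄ → N (fromℤ n * q)
                  → HalfCoset q (q * (1/ fromℤ n * ½)) → N q
  divide-multiple q n nq∈ (m , d∈) =
    subst N value (+-closed (ℤ-multiple n d∈) (ℤ-multiple (m ℤ.+ m) nq∈))
    where
    open ≡-Reasoning
    u : ℚ
    u = 1/ fromℤ n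
    value : fromℤ n * (2ℚ * (q * (u * ½) - fromℤ m * q)) + fromℤ (m ℤ.+ m) * (fromℤ n * q) ≡ q
    value = begin
      fromℤ n * (2ℚ * (q * (u * ½) - fromℤ m * q)) + fromℤ (m ℤ.+ m) * (fromℤ n * q)
        ≡⟨ cong (λ z → fromℤ n * (2ℚ * (q * (u * ½) - fromℤ m * q)) + z * (fromℤ n * q)) (fromℤ-+ m m) ⟩
      fromℤ n * (2ℚ * (q * (u * ½) - fromℤ m * q)) + (fromℤ m + fromℤ m) * (fromℤ n * q)
        ≡⟨ solve 4 (λ a u m q →
             a :* (con 2ℚ :* (q :* (u :* con ½) :- m :* q)) :+ (m :+ m) :* (a :* q) := (a :* u) :* q)
             refl (fromℤ n) u (fromℤ m) q ⟩
      (fromℤ n * u) * q ≡⟨ cong (_* q) (ℚP.*-inverseʳ (fromℤ n)) ⟩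
      1ℚ * q            ≡⟨ ℚP.*-identityˡ q ⟩
      q ∎

  halfCoset-total⇒∈ : ∀ q → (∀ x → HalfCoset q x) → N q
  halfCoset-total⇒∈ q total = divide (odd-multiple q (total (q * ½)))
    where
    divide : (Σ ℤ λ n → fromℤ n ≢ 0ℚ × N (fromℤ n * q)) → N q
    divide (n , n≢0 , nq∈) = divide-multiple q n nq∈ (total (q * (1/ fromℤ n * ½)))
      where
      instance
        nonZero : ℚ.NonZero (fromℤ n)
        nonZero = ℚ.≢-nonZero n≢0

Translation : Pred ℚ 0ℓ → Pred ℚ 0ℓ
Translation Q d = ∀ x → Q x → Q (x + d) × Q (x - d)

translation-subgroup : ∀ Q → IsAdditiveSubgroup (Translation Q)
translation-subgroup Q = record
  { 0∈       = λ x x∈ → subst Q (sym (ℚP.+-identityʳ x)) x∈ , subst Q (sym (ℚP.+-identityʳ x)) x∈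
  ; +-closed = λ {d} {e} d∈ e∈ x x∈ →
      subst Q (ℚP.+-assoc x d e) (proj₁ (e∈ _ (proj₁ (d∈ x x∈)))) ,
      subst Q (solve 3 (λ x d e → (x :- d) :- e := x :- (d :+ e)) refl x d e) (proj₂ (e∈ _ (proj₂ (d∈ x x∈))))
  ; neg-closed = λ {d} d∈ x x∈ →
      proj₂ (d∈ x x∈) ,
      subst Q (solve 2 (λ x d → x :+ d := x :- (:- d)) refl x d) (proj₁ (d∈ x x∈))
  }

-- For a ▷-closed Q, twice the difference of two points of Q is a translation of Q,
-- since a ▷ (b ▷ x) = x + 2(a − b) and b ▷ (a ▷ x) = x − 2(a − b).
doubled-difference : ∀ {Q a b} → Closed Q → Q a → Q b → Translation Q (2ℚ * (a - b))
doubled-difference {Q} {a} {b} closed a∈ b∈ x x∈ =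
  subst Q forward (closed a∈ (closed b∈ x∈)) , subst Q backward (closed b∈ (closed a∈ x∈))
  where
  forward : a ▷ℚ (b ▷ℚ x) ≡ x + 2ℚ * (a - b)
  forward = solve 3 (λ a b x → con 2ℚ :* a :- (con 2ℚ :* b :- x) := x :+ con 2ℚ :* (a :- b)) refl a b x
  backward : b ▷ℚ (a ▷ℚ x) ≡ x - 2ℚ * (a - b)
  backward = solve 3 (λ a b x → con 2ℚ :* b :- (con 2ℚ :* a :- x) := x :- con 2ℚ :* (a :- b)) refl a b x

-- A ▷-closed set Q' that together with 0 generates ℚ must contain 0: for q ∈ Q', the half-coset
-- ℤq + ½N of its translation group N is ▷-closed and contains 0 and Q', hence is all of ℚ;
-- so q ∈ N and 0 = q − q ∈ Q'.
generating-closed-set∋0 : ∀ {Q' q} → Closed Q' → Q' q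
                        → (∀ x → ⟪ (λ y → IsZero y ⊎ Q' y) ⟫ x) → Q' 0ℚ
generating-closed-set∋0 {Q'} {q} closed q∈ generates =
  subst Q' (ℚP.+-inverseʳ q) (proj₂ (q-translation q q∈))
  where
  open AdditiveSubgroup (translation-subgroup Q')
  generators⊆ : ∀ y → IsZero y ⊎ Q' y → HalfCoset q y
  generators⊆ y (inj₁ refl) = + 0 , subst (Translation Q') (sym zero-offset) (IsAdditiveSubgroup.0∈ (translation-subgroup Q'))
    where
    zero-offset : 2ℚ * (0ℚ - fromℤ (+ 0) * q) ≡ 0ℚ
    zero-offset = solve 1 (λ q → con 2ℚ :* (con 0ℚ :- con 0ℚ :* q) := con 0ℚ) refl q
  generators⊆ y (inj₂ y∈) = + 1 , subst (Translation Q') unit-offset (doubled-difference closed y∈ q∈)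
    where
    unit-offset : 2ℚ * (y - q) ≡ 2ℚ * (y - fromℤ (+ 1) * q)
    unit-offset = cong (λ z → 2ℚ * (y - z)) (sym (ℚP.*-identityˡ q))
  q-translation : Translation Q' q
  q-translation = halfCoset-total⇒∈ q λ x →
    generated⊆closed (HalfCoset q) (λ {a} {b} → halfCoset-closed q {a} {b}) generators⊆ x (generates x)

theorem5p2 : ¬ RackNotions.Complemented _▷ℚ_
theorem5p2 complemented = refute (complemented IsZero (closed⇒subrack zero-closed))
  where
  refute : Σ (Pred ℚ 0ℓ) (IsComplement IsZero) → ⊥
  refute (Q' , (closed , _) , disjoint , generates) =
    disjoint 0ℚ refl (generating-closed-set∋0 closed (proj₂ (complement-inhabited generates)) generates)
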